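{- Let $v_1=v_1(z)$ be the unique root of the cubic equation $z u^3+(z^2-1)u^2-z^3u+z^2=0$ (in the unknown $u$) that is a formal Laurent series in $z$ of the form $v_1=\frac1z-z-z^5-2z^7-4z^9-\cdots$. For $n\ge1$, let $a_n$ be the number of Dyck paths of length $2n$ (semilength $n$) in which every descent has odd length, and let $g_0(z)=\sum_{n\ge1}a_nz^{2n}$. Then $$g_0=\frac{z v_1}{v_1^2-z^2},$$ and $g_0$ satisfies $$g_0=\frac{z^2(1+g_0)}{1-z^4(1+g_0)^2},$$ equivalently, with $Z=z^2$, $-Z^2g_0^3-2Z^2g_0^2+g_0-Z^2g_0-Zg_0-Z=0$. In particular $g_0=Z+Z^2+2Z^3+5Z^4+12Z^5+30Z^6+79Z^7+\cdots$ (OEIS A101785).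
   Context: A Dyck path is a finite sequence of up-steps $(1,1)$ and down-steps $(1,-1)$ starting at the origin, never going below the $x$-axis and ending on the $x$-axis; the empty path is not considered. A descent is a maximal run of consecutive down-steps; its length is the number of down-steps in it. -}

module Defs where

open import Data.Nat as ℕ using (ℕ; zero; suc)
open import Data.Integer as ℤ using (ℤ; +_; -[1+_])
open import Data.Bool using (Bool; true; false; _∧_; if_then_else_)
open import Data.List using (List; []; _∷_; _++_; length; foldr; map; concatMap; upTo; filterᵇ)
open import Data.Maybe using (Maybe; just; nothing)
open import Data.Product using (_×_)
open import Data.Unit using (⊤)
open import Relation.Binary.PropositionalEquality using (_≡_)

-- Formal power series in z with integer coefficients:
-- f represents  Σ_{n ≥ 0} f n · z^n.

FPS : Set
FPS = ℕ → ℤ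

infix 4 _≈_
_≈_ : FPS → FPS → Set
f ≈ g = ∀ n → f n ≡ g n

infixl 6 _⊕_ _⊖_
infixl 7 _⊗_

κ : ℤ → FPS
κ c zero    = c
κ c (suc n) = + 0

zpow : ℕ → FPS
zpow k n = if k ℕ.≡ᵇ n then + 1 else + 0

_⊕_ : FPS → FPS → FPS
(f ⊕ g) n = f n ℤ.+ g n

⊝_ : FPS → FPS
(⊝ f) n = ℤ.- (f n)

_⊖_ : FPS → FPS → FPS
f ⊖ g = f ⊕ (⊝ g)

_⊗_ : FPS → FPS → FPS
(f ⊗ g) n = foldr ℤ._+_ (+ 0) (map (λ i → f i ℤ.* g (n ℕ.∸ i)) (upTo (suc n)))

-- substitution z ↦ z² :  (sub2 G) represents G(z²)
sub2 : FPS → FPS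
sub2 G zero          = G zero
sub2 G (suc zero)    = + 0
sub2 G (suc (suc k)) = sub2 (λ m → G (suc m)) k

Prefix : List ℤ → FPS → Set
Prefix []       f = ⊤
Prefix (c ∷ cs) f = (f 0 ≡ c) × Prefix cs (λ m → f (suc m))

data Step : Set where
  U D : Step

words : ℕ → List (List Step)
words zero    = [] ∷ []
words (suc n) = concatMap (λ w → (U ∷ w) ∷ (D ∷ w) ∷ []) (words n)

walk : ℕ → List Step → Maybe ℕ
walk h []       = just h
walk h (U ∷ s)  = walk (suc h) s
walk zero (D ∷ s)    = nothing
walk (suc h) (D ∷ s) = walk h s

isDyck : List Step → Bool
isDyck s with walk 0 s
... | just zero    = true
... | just (suc _) = false
... | nothing      = false

-- lengths of the descents (maximal runs of consecutive down-steps),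
-- c = length of the run of down-steps currently being read
descentsFrom : ℕ → List Step → List ℕ
descentsFrom zero    []      = []
descentsFrom (suc c) []      = suc c ∷ []
descentsFrom c       (D ∷ s) = descentsFrom (suc c) s
descentsFrom zero    (U ∷ s) = descentsFrom 0 s
descentsFrom (suc c) (U ∷ s) = suc c ∷ descentsFrom 0 s

descents : List Step → List ℕ
descents = descentsFrom 0

isOdd : ℕ → Bool
isOdd zero          = false
isOdd (suc zero)    = true
isOdd (suc (suc n)) = isOdd n

allOdd : List ℕ → Bool
allOdd []       = true
allOdd (x ∷ xs) = isOdd x ∧ allOdd xs

-- a n = number of Dyck paths of semilength n (length 2n) all of whose
-- descents have odd length, for n ≥ 1; the empty path is not counted.
a : ℕ → ℕ
a zero    = 0
a (suc n) = length (filterᵇ (λ p → isDyck p ∧ allOdd (descents p))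
                            (words (2 ℕ.* suc n)))

-- G(Z) = Σ_{n ≥ 1} a_n Z^n   (series in Z = z²)
G : FPS
G n = + (a n)

g₀ : FPS
g₀ = sub2 G

-- For v a formal Laurent series with v = z⁻¹ · w (w a power series),
-- the cubic  z v³ + (z² - 1) v² - z³ v + z² = 0, multiplied by z², reads
--   w³ + (z² - 1) w² - z⁴ w + z⁴ = 0.
CubicRoot : FPS → Set
CubicRoot w =
  (w ⊗ w ⊗ w) ⊕ ((zpow 2 ⊖ κ (+ 1)) ⊗ (w ⊗ w)) ⊖ (zpow 4 ⊗ w) ⊕ zpow 4 ≈ κ (+ 0)

-- Read a step sequence from left to right, remembering the height and the parity class of
-- the descent in progress: the admissible continuations satisfy a transfer recursion (paths).
-- Their generating function has a closed form V in terms of the power series g with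
-- g = z²(1+g) + z⁴g(1+g)², which exists because the right side is contracting, and checking
-- that V satisfies the recursion uses only this equation; hence g₀ = g.  The rest is algebra
-- in ℤ[[z]]: w₁ = 1/(1+g₀) is a root of the cubic, a root with constant term 1 is unique
-- because the difference quotient of the cubic has constant term 1, and every identity is an
-- explicit combination of g₀ - Φ(g₀) and w₁(1+g₀) - 1, checked by the ring solver.
-- Substituting z² for Z carries the equation of g₀ back to G.
module Submission where

open import Defs
open import Algebra.Bundles using (CommutativeRing)
open import Algebra.Structures using (IsCommutativeRing)
import Algebra.Solver.Ring
open import Algebra.Solver.Ring.AlmostCommutativeRing
  using (fromCommutativeRing; _-Raw-AlmostCommutative⟶_)
open import Data.Bool using (Bool; true; false; _∧_; if_then_else_)
import Data.Bool.Properties as Boolₚ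
open import Data.Integer as ℤ using (ℤ; +_; -[1+_])
import Data.Integer.Properties as ℤₚ
open import Data.Integer.Tactic.RingSolver using (solve-∀)
open import Data.List using (List; []; _∷_; foldr; map; applyUpTo; length; filterᵇ; concatMap)
open import Data.Maybe using (Maybe; just; nothing)
open import Data.Nat as ℕ using (ℕ; zero; suc; _<_; _≤_; z≤n; s≤s)
import Data.Nat.Properties as ℕₚ
open import Data.Product using (_×_; _,_; proj₁; proj₂; ∃-syntax)
open import Data.Unit using (tt)
open import Data.Sum using (inj₁; inj₂)
open import Data.Vec as Vec using (allFin)
open import Data.Vec.N-ary using (N-ary; _$ⁿ_; Eq; curryⁿ; curryⁿ-cong)
open import Function using (_∘_; id)
open import Relation.Binary.PropositionalEquality
import Relation.Binary.Reasoning.Setoid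
open import Relation.Nullary using (yes; no)

tail : FPS → FPS
tail f n = f (suc n)

shift : FPS → FPS
shift f zero    = + 0
shift f (suc n) = f n

infixr 8 _·_
_·_ : ℤ → FPS → FPS
(c · f) n = c ℤ.* f n

0F 1F : FPS
0F = κ (+ 0)
1F = κ (+ 1)

0F≡0 : ∀ n → 0F n ≡ + 0
0F≡0 zero    = refl
0F≡0 (suc n) = refl

≈-refl : ∀ {f} → f ≈ f
≈-refl n = refl

≈-sym : ∀ {f g} → f ≈ g → g ≈ f
≈-sym p n = sym (p n)

≈-trans : ∀ {f g h} → f ≈ g → g ≈ h → f ≈ h
≈-trans p q n = trans (p n) (q n)

-- The Cauchy product by recursion on the index; its laws are proved by induction and
-- transported to _⊗_ along ⊗≈⊛.
infixl 7 _⊛_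
_⊛_ : FPS → FPS → FPS
(f ⊛ g) zero    = f 0 ℤ.* g 0
(f ⊛ g) (suc n) = f 0 ℤ.* g (suc n) ℤ.+ (tail f ⊛ g) n

map-applyUpTo : ∀ {A B : Set} (h : A → B) (k : ℕ → A) n →
                map h (applyUpTo k n) ≡ applyUpTo (h ∘ k) n
map-applyUpTo h k zero    = refl
map-applyUpTo h k (suc n) = cong (h (k 0) ∷_) (map-applyUpTo h (k ∘ suc) n)

sum-convolution≡⊛ : ∀ n f g →
  foldr ℤ._+_ (+ 0) (applyUpTo (λ i → f i ℤ.* g (n ℕ.∸ i)) (suc n)) ≡ (f ⊛ g) n
sum-convolution≡⊛ zero    f g = ℤₚ.+-identityʳ (f 0 ℤ.* g 0)
sum-convolution≡⊛ (suc n) f g = cong (ℤ._+_ (f 0 ℤ.* g (suc n))) (sum-convolution≡⊛ n (tail f) g)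

⊗≈⊛ : ∀ f g → f ⊗ g ≈ f ⊛ g
⊗≈⊛ f g n = trans (cong (foldr ℤ._+_ (+ 0)) (map-applyUpTo (λ i → f i ℤ.* g (n ℕ.∸ i)) id (suc n)))
                  (sum-convolution≡⊛ n f g)

⊛-cong : ∀ {f f′ g g′} → f ≈ f′ → g ≈ g′ → f ⊛ g ≈ f′ ⊛ g′
⊛-cong p q zero    = cong₂ ℤ._*_ (p 0) (q 0)
⊛-cong p q (suc n) = cong₂ ℤ._+_ (cong₂ ℤ._*_ (p 0) (q (suc n))) (⊛-cong (p ∘ suc) q n)

zeros-⊛ : ∀ g n → ((λ _ → + 0) ⊛ g) n ≡ + 0
zeros-⊛ g zero    = refl
zeros-⊛ g (suc n) = cong (ℤ._+_ (+ 0)) (zeros-⊛ g n)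

κ-⊛ : ∀ c g → κ c ⊛ g ≈ c · g
κ-⊛ c g zero    = refl
κ-⊛ c g (suc n) = trans (cong (ℤ._+_ (c ℤ.* g (suc n))) (zeros-⊛ g n)) (ℤₚ.+-identityʳ _)

⊛-identityˡ : ∀ g → 1F ⊛ g ≈ g
⊛-identityˡ g n = trans (κ-⊛ (+ 1) g n) (ℤₚ.*-identityˡ (g n))

⊛-shiftˡ : ∀ f g → shift f ⊛ g ≈ shift (f ⊛ g)
⊛-shiftˡ f g zero    = refl
⊛-shiftˡ f g (suc n) = ℤₚ.+-identityˡ _

⊛-scaleˡ : ∀ c f g → (c · f) ⊛ g ≈ c · (f ⊛ g)
⊛-scaleˡ c f g zero    = ℤₚ.*-assoc c (f 0) (g 0)
⊛-scaleˡ c f g (suc n) =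
  trans (cong (ℤ._+_ (c ℤ.* f 0 ℤ.* g (suc n))) (⊛-scaleˡ c (tail f) g n))
        (rearrange c (f 0) (g (suc n)) ((tail f ⊛ g) n))
  where
  rearrange : ∀ c a b d → c ℤ.* a ℤ.* b ℤ.+ c ℤ.* d ≡ c ℤ.* (a ℤ.* b ℤ.+ d)
  rearrange = solve-∀

⊛-distribˡ : ∀ f g h → f ⊛ (g ⊕ h) ≈ f ⊛ g ⊕ f ⊛ h
⊛-distribˡ f g h zero    = ℤₚ.*-distribˡ-+ (f 0) (g 0) (h 0)
⊛-distribˡ f g h (suc n) =
  trans (cong (ℤ._+_ (f 0 ℤ.* (g (suc n) ℤ.+ h (suc n)))) (⊛-distribˡ (tail f) g h n))
        (rearrange (f 0) (g (suc n)) (h (suc n)) ((tail f ⊛ g) n) ((tail f ⊛ h) n))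
  where
  rearrange : ∀ a b c d e → a ℤ.* (b ℤ.+ c) ℤ.+ (d ℤ.+ e) ≡ a ℤ.* b ℤ.+ d ℤ.+ (a ℤ.* c ℤ.+ e)
  rearrange = solve-∀

⊛-expandʳ : ∀ f g → f ⊛ g ≈ g 0 · f ⊕ shift (f ⊛ tail g)
⊛-expandʳ f g zero          = trans (ℤₚ.*-comm (f 0) (g 0)) (sym (ℤₚ.+-identityʳ _))
⊛-expandʳ f g (suc zero)    =
  trans (cong (ℤ._+_ (f 0 ℤ.* g 1)) (⊛-expandʳ (tail f) g 0))
        (rearrange (f 0 ℤ.* g 1) (g 0 ℤ.* f 1))
  where
  rearrange : ∀ a b → a ℤ.+ (b ℤ.+ + 0) ≡ b ℤ.+ a
  rearrange = solve-∀
⊛-expandʳ f g (suc (suc n)) =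
  trans (cong (ℤ._+_ (f 0 ℤ.* g (suc (suc n)))) (⊛-expandʳ (tail f) g (suc n)))
        (rearrange (f 0 ℤ.* g (suc (suc n))) (g 0 ℤ.* f (suc (suc n))) ((tail f ⊛ tail g) n))
  where
  rearrange : ∀ a b c → a ℤ.+ (b ℤ.+ c) ≡ b ℤ.+ (a ℤ.+ c)
  rearrange = solve-∀

⊛-comm : ∀ f g → f ⊛ g ≈ g ⊛ f
⊛-comm f g zero    = ℤₚ.*-comm (f 0) (g 0)
⊛-comm f g (suc n) =
  trans (cong (ℤ._+_ (f 0 ℤ.* g (suc n))) (⊛-comm (tail f) g n)) (sym (⊛-expandʳ g f (suc n)))

⊛-distribʳ : ∀ f g h → (f ⊕ g) ⊛ h ≈ f ⊛ h ⊕ g ⊛ h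
⊛-distribʳ f g h n =
  trans (⊛-comm (f ⊕ g) h n)
        (trans (⊛-distribˡ h f g n) (cong₂ ℤ._+_ (⊛-comm h f n) (⊛-comm h g n)))

⊛-assoc : ∀ f g h → (f ⊛ g) ⊛ h ≈ f ⊛ (g ⊛ h)
⊛-assoc f g h zero    = ℤₚ.*-assoc (f 0) (g 0) (h 0)
⊛-assoc f g h (suc n) = begin
    f 0 ℤ.* g 0 ℤ.* h (suc n) ℤ.+ ((f 0 · tail g ⊕ tail f ⊛ g) ⊛ h) n
  ≡⟨ cong (ℤ._+_ (f 0 ℤ.* g 0 ℤ.* h (suc n))) (⊛-distribʳ (f 0 · tail g) (tail f ⊛ g) h n) ⟩
    f 0 ℤ.* g 0 ℤ.* h (suc n) ℤ.+ (((f 0 · tail g) ⊛ h) n ℤ.+ ((tail f ⊛ g) ⊛ h) n)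
  ≡⟨ cong₂ (λ u v → f 0 ℤ.* g 0 ℤ.* h (suc n) ℤ.+ (u ℤ.+ v))
           (⊛-scaleˡ (f 0) (tail g) h n) (⊛-assoc (tail f) g h n) ⟩
    f 0 ℤ.* g 0 ℤ.* h (suc n) ℤ.+ (f 0 ℤ.* (tail g ⊛ h) n ℤ.+ (tail f ⊛ (g ⊛ h)) n)
  ≡⟨ rearrange (f 0) (g 0) (h (suc n)) _ _ ⟩
    f 0 ℤ.* (g 0 ℤ.* h (suc n) ℤ.+ (tail g ⊛ h) n) ℤ.+ (tail f ⊛ (g ⊛ h)) n
  ∎
  where
  open ≡-Reasoning
  rearrange : ∀ a b c d e → a ℤ.* b ℤ.* c ℤ.+ (a ℤ.* d ℤ.+ e) ≡ a ℤ.* (b ℤ.* c ℤ.+ d) ℤ.+ e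
  rearrange = solve-∀

⊕-cong : ∀ {f f′ g g′} → f ≈ f′ → g ≈ g′ → f ⊕ g ≈ f′ ⊕ g′
⊕-cong p q n = cong₂ ℤ._+_ (p n) (q n)

⊗≈⊛-cong : ∀ {f f′ g g′} → f ≈ f′ → g ≈ g′ → f ⊗ g ≈ f′ ⊛ g′
⊗≈⊛-cong {f} {g = g} p q = ≈-trans (⊗≈⊛ f g) (⊛-cong p q)

⊗-cong : ∀ {f f′ g g′} → f ≈ f′ → g ≈ g′ → f ⊗ g ≈ f′ ⊗ g′
⊗-cong {f′ = f′} {g′ = g′} p q = ≈-trans (⊗≈⊛-cong p q) (≈-sym (⊗≈⊛ f′ g′))

⊗-congˡ : ∀ f {g g′} → g ≈ g′ → f ⊗ g ≈ f ⊗ g′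
⊗-congˡ f = ⊗-cong (≈-refl {f})

⊗-congʳ : ∀ {f f′} g → f ≈ f′ → f ⊗ g ≈ f′ ⊗ g
⊗-congʳ g p = ⊗-cong p (≈-refl {g})

⊗-assoc : ∀ f g h → (f ⊗ g) ⊗ h ≈ f ⊗ (g ⊗ h)
⊗-assoc f g h = ≈-trans (⊗≈⊛-cong (⊗≈⊛ f g) ≈-refl)
                        (≈-trans (⊛-assoc f g h) (≈-sym (⊗≈⊛-cong ≈-refl (⊗≈⊛ g h))))

⊗-comm : ∀ f g → f ⊗ g ≈ g ⊗ f
⊗-comm f g = ≈-trans (⊗≈⊛ f g) (≈-trans (⊛-comm f g) (≈-sym (⊗≈⊛ g f)))

⊗-identityˡ : ∀ f → 1F ⊗ f ≈ f
⊗-identityˡ f = ≈-trans (⊗≈⊛ 1F f) (⊛-identityˡ f)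

⊗-distribˡ : ∀ f g h → f ⊗ (g ⊕ h) ≈ f ⊗ g ⊕ f ⊗ h
⊗-distribˡ f g h = ≈-trans (⊗≈⊛ f (g ⊕ h))
                           (≈-trans (⊛-distribˡ f g h) (≈-sym (⊕-cong (⊗≈⊛ f g) (⊗≈⊛ f h))))

⊗-distribʳ : ∀ h f g → (f ⊕ g) ⊗ h ≈ f ⊗ h ⊕ g ⊗ h
⊗-distribʳ h f g = ≈-trans (⊗≈⊛ (f ⊕ g) h)
                           (≈-trans (⊛-distribʳ f g h) (≈-sym (⊕-cong (⊗≈⊛ f h) (⊗≈⊛ g h))))

FPS-isCommutativeRing : IsCommutativeRing _≈_ _⊕_ _⊗_ ⊝_ 0F 1F
FPS-isCommutativeRing = record
  { isRing = record
    { +-isAbelianGroup = record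
      { isGroup = record
        { isMonoid = record
          { isSemigroup = record
            { isMagma = record
              { isEquivalence = record { refl = ≈-refl ; sym = ≈-sym ; trans = ≈-trans }
              ; ∙-cong        = ⊕-cong
              }
            ; assoc = λ f g h n → ℤₚ.+-assoc (f n) (g n) (h n)
            }
          ; identity = (λ f n → trans (cong (ℤ._+ f n) (0F≡0 n)) (ℤₚ.+-identityˡ (f n)))
                     , (λ f n → trans (cong (ℤ._+_ (f n)) (0F≡0 n)) (ℤₚ.+-identityʳ (f n)))
          }
        ; inverse = (λ f n → trans (ℤₚ.+-inverseˡ (f n)) (sym (0F≡0 n)))
                  , (λ f n → trans (ℤₚ.+-inverseʳ (f n)) (sym (0F≡0 n)))
        ; ⁻¹-cong = λ p n → cong ℤ.-_ (p n)
        }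
      ; comm = λ f g n → ℤₚ.+-comm (f n) (g n)
      }
    ; *-cong     = ⊗-cong
    ; *-assoc    = ⊗-assoc
    ; *-identity = ⊗-identityˡ , λ f → ≈-trans (⊗-comm f 1F) (⊗-identityˡ f)
    ; distrib    = ⊗-distribˡ , ⊗-distribʳ
    }
  ; *-comm = ⊗-comm
  }

FPS-ring : CommutativeRing _ _
FPS-ring = record { isCommutativeRing = FPS-isCommutativeRing }

κ-homomorphism : ℤ.+-*-rawRing -Raw-AlmostCommutative⟶ fromCommutativeRing FPS-ring
κ-homomorphism = record
  { ⟦_⟧    = κ
  ; +-homo = λ a b → λ { zero → refl ; (suc n) → refl }
  ; *-homo = λ a b → ≈-sym (≈-trans (⊗≈⊛ (κ a) (κ b)) (≈-trans (κ-⊛ a (κ b)) (scale-κ a b)))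
  ; -‿homo = λ a → λ { zero → refl ; (suc n) → refl }
  ; 0-homo = ≈-refl
  ; 1-homo = ≈-refl
  }
  where
  scale-κ : ∀ a b → a · κ b ≈ κ (a ℤ.* b)
  scale-κ a b zero    = refl
  scale-κ a b (suc n) = ℤₚ.*-zeroʳ a

κ-≟ : ∀ a b → Maybe (κ a ≈ κ b)
κ-≟ a b with a ℤ.≟ b
... | yes refl = just ≈-refl
... | no _     = nothing

open Algebra.Solver.Ring ℤ.+-*-rawRing (fromCommutativeRing FPS-ring) κ-homomorphism κ-≟
  using (Polynomial; _:+_; _:*_; _:-_; :-_; con; var; _:=_; prove; normalise; ⟦_⟧; ⟦_⟧N)

close : ∀ n → N-ary n (Polynomial n) (Polynomial n × Polynomial n) → Polynomial n × Polynomial n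
close n f = f $ⁿ Vec.map var (allFin n)

-- Algebra.Solver.Ring.solve compares the evaluated normal forms, which unfolds the
-- convolution sums of _⊗_ and is exponentially slow; solve≡ compares them as syntax.
solve≡ : ∀ n f → let (p , q) = close n f in
         normalise p ≡ normalise q → Eq n _≈_ (curryⁿ ⟦ p ⟧) (curryⁿ ⟦ q ⟧)
solve≡ n f eq = curryⁿ-cong _≈_ ⟦ p ⟧ ⟦ q ⟧ (λ ρ → prove ρ p q (λ k → cong (λ N → ⟦ N ⟧N ρ k) eq))
  where
  p = proj₁ (close n f)
  q = proj₂ (close n f)

module _ {n : ℕ} where

  :1 : Polynomial n
  :1 = con (+ 1)

  :Φ : Polynomial n → Polynomial n → Polynomial n → Polynomial n
  :Φ s q g = s :* (:1 :+ g) :+ q :* (g :* ((:1 :+ g) :* (:1 :+ g)))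

  :cubic : Polynomial n → Polynomial n → Polynomial n → Polynomial n
  :cubic s q w = (w :* w :* w) :+ ((s :- :1) :* (w :* w)) :- (q :* w) :+ q

open CommutativeRing FPS-ring using (+-group; zeroˡ; zeroʳ; +-identityʳ)
open import Algebra.Properties.Group +-group using (x∙y⁻¹≈ε⇒x≈y; x≈y⇒x∙y⁻¹≈ε; ∙-cancelˡ)
module ≈-Reasoning = Relation.Binary.Reasoning.Setoid (CommutativeRing.setoid FPS-ring)

shift-cong : ∀ {f g} → f ≈ g → shift f ≈ shift g
shift-cong p zero    = refl
shift-cong p (suc n) = p n

⊗-shiftˡ : ∀ f g → shift f ⊗ g ≈ shift (f ⊗ g)
⊗-shiftˡ f g = ≈-trans (⊗≈⊛ (shift f) g) (≈-trans (⊛-shiftˡ f g) (shift-cong (≈-sym (⊗≈⊛ f g))))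

zpow-zero : zpow 0 ≈ 1F
zpow-zero zero    = refl
zpow-zero (suc n) = refl

zpow-suc : ∀ k → zpow (suc k) ≈ shift (zpow k)
zpow-suc k zero    = refl
zpow-suc k (suc n) = refl

zpow-+ : ∀ m n → zpow (m ℕ.+ n) ≈ zpow m ⊗ zpow n
zpow-+ zero    n = ≈-sym (≈-trans (⊗-congʳ (zpow n) zpow-zero) (⊗-identityˡ (zpow n)))
zpow-+ (suc m) n = begin
  zpow (suc (m ℕ.+ n))     ≈⟨ zpow-suc (m ℕ.+ n) ⟩
  shift (zpow (m ℕ.+ n))   ≈⟨ shift-cong (zpow-+ m n) ⟩
  shift (zpow m ⊗ zpow n)  ≈⟨ ⊗-shiftˡ (zpow m) (zpow n) ⟨
  shift (zpow m) ⊗ zpow n  ≈⟨ ⊗-congʳ (zpow n) (zpow-suc m) ⟨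
  zpow (suc m) ⊗ zpow n    ∎
  where open ≈-Reasoning

zpow1⊗ : ∀ f → zpow 1 ⊗ f ≈ shift f
zpow1⊗ f = begin
  zpow 1 ⊗ f       ≈⟨ ⊗-congʳ f (≈-trans (zpow-suc 0) (shift-cong zpow-zero)) ⟩
  shift 1F ⊗ f     ≈⟨ ⊗-shiftˡ 1F f ⟩
  shift (1F ⊗ f)   ≈⟨ shift-cong (⊗-identityˡ f) ⟩
  shift f          ∎
  where open ≈-Reasoning

multiple≈0 : ∀ {r} A → r ≈ 0F → r ⊗ A ≈ 0F
multiple≈0 A r≈0 = ≈-trans (⊗-congʳ A r≈0) (zeroˡ A)

combination≈0 : ∀ {r s} A B → r ≈ 0F → s ≈ 0F → r ⊗ A ⊕ s ⊗ B ≈ 0F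
combination≈0 A B r≈0 s≈0 = ≈-trans (⊕-cong (multiple≈0 A r≈0) (multiple≈0 B s≈0)) (+-identityʳ 0F)

Agree : ℕ → FPS → FPS → Set
Agree n f g = ∀ m → m < n → f m ≡ g m

Agree-weaken : ∀ {m n f g} → m ≤ n → Agree n f g → Agree m f g
Agree-weaken m≤n p i i<m = p i (ℕₚ.<-≤-trans i<m m≤n)

Agree-⊕ : ∀ {n f f′ g g′} → Agree n f f′ → Agree n g g′ → Agree n (f ⊕ g) (f′ ⊕ g′)
Agree-⊕ p q m m<n = cong₂ ℤ._+_ (p m m<n) (q m m<n)

Agree-⊝ : ∀ {n f f′} → Agree n f f′ → Agree n (⊝ f) (⊝ f′)
Agree-⊝ p m m<n = cong ℤ.-_ (p m m<n)

⊛-agree : ∀ m {f f′ g g′} → Agree (suc m) f f′ → Agree (suc m) g g′ → (f ⊛ g) m ≡ (f′ ⊛ g′) m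
⊛-agree zero    p q = cong₂ ℤ._*_ (p 0 (s≤s z≤n)) (q 0 (s≤s z≤n))
⊛-agree (suc m) p q =
  cong₂ ℤ._+_ (cong₂ ℤ._*_ (p 0 (s≤s z≤n)) (q (suc m) ℕₚ.≤-refl))
              (⊛-agree m (λ i i<m → p (suc i) (s≤s i<m)) (Agree-weaken (ℕₚ.n≤1+n _) q))

Agree-⊗ : ∀ {n f f′ g g′} → Agree n f f′ → Agree n g g′ → Agree n (f ⊗ g) (f′ ⊗ g′)
Agree-⊗ {f = f} {f′} {g} {g′} p q m m<n =
  trans (⊗≈⊛ f g m) (trans (⊛-agree m (Agree-weaken m<n p) (Agree-weaken m<n q)) (sym (⊗≈⊛ f′ g′ m)))

⊛-agree-vanishing : ∀ m {f g g′} → f 0 ≡ + 0 → Agree m g g′ → (f ⊛ g) m ≡ (f ⊛ g′) m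
⊛-agree-vanishing zero    {g = g} {g′} f₀ q = trans (cong (ℤ._* g 0) f₀) (sym (cong (ℤ._* g′ 0) f₀))
⊛-agree-vanishing (suc m) {g = g} {g′} f₀ q =
  cong₂ ℤ._+_ (trans (cong (ℤ._* g (suc m)) f₀) (sym (cong (ℤ._* g′ (suc m)) f₀)))
              (⊛-agree m (λ _ _ → refl) q)

Agree-⊗-vanishing : ∀ {n} f {g g′} → f 0 ≡ + 0 → Agree n g g′ → Agree (suc n) (f ⊗ g) (f ⊗ g′)
Agree-⊗-vanishing f {g} {g′} f₀ q m (s≤s m≤n) =
  trans (⊗≈⊛ f g m) (trans (⊛-agree-vanishing m f₀ (Agree-weaken m≤n q)) (sym (⊗≈⊛ f g′ m)))

Contracting : (FPS → FPS) → Set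
Contracting Ψ = ∀ {n f g} → Agree n f g → Agree (suc n) (Ψ f) (Ψ g)

module Fixpoint (Ψ : FPS → FPS) (contracting : Contracting Ψ) where

  approx : ℕ → FPS
  approx zero    = 0F
  approx (suc k) = Ψ (approx k)

  fix : FPS
  fix n = approx (suc n) n

  approx-agree : ∀ k → Agree k (approx k) (approx (suc k))
  approx-agree zero    m ()
  approx-agree (suc k) = contracting (approx-agree k)

  approx-fix : ∀ k → Agree k (approx k) fix
  approx-fix (suc k) m (s≤s m≤k) with ℕₚ.m≤n⇒m<n∨m≡n m≤k
  ... | inj₁ m<k  = trans (sym (approx-agree k m m<k)) (approx-fix k m m<k)
  ... | inj₂ refl = refl

  fix-unfold : fix ≈ Ψ fix
  fix-unfold n = sym (contracting (λ m m<n → sym (approx-fix n m m<n)) n ℕₚ.≤-refl)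

recip-contracting : ∀ f → f 0 ≡ + 0 → Contracting (λ w → 1F ⊖ f ⊗ w)
recip-contracting f f₀ p = Agree-⊕ {f = 1F} {1F} (λ _ _ → refl) (Agree-⊝ (Agree-⊗-vanishing f f₀ p))

recip : (f : FPS) → f 0 ≡ + 0 → FPS
recip f f₀ = Fixpoint.fix (λ w → 1F ⊖ f ⊗ w) (recip-contracting f f₀)

recip-inverse : ∀ f f₀ → recip f f₀ ⊗ (1F ⊕ f) ≈ 1F
recip-inverse f f₀ = x∙y⁻¹≈ε⇒x≈y _ _ (begin
  w ⊗ (1F ⊕ f) ⊖ 1F        ≈⟨ solve≡ 2 (λ w f → w :* (:1 :+ f) :- :1 := (w :- (:1 :- f :* w)) :* :1) refl w f ⟩
  (w ⊖ (1F ⊖ f ⊗ w)) ⊗ 1F  ≈⟨ multiple≈0 1F (x≈y⇒x∙y⁻¹≈ε unfold) ⟩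
  0F                       ∎)
  where
  open ≈-Reasoning
  w = recip f f₀
  unfold : w ≈ 1F ⊖ f ⊗ w
  unfold = Fixpoint.fix-unfold (λ w → 1F ⊖ f ⊗ w) (recip-contracting f f₀)

⊗-cancel-unit : ∀ K d → K 0 ≡ + 1 → K ⊗ d ≈ 0F → d ≈ 0F
⊗-cancel-unit K d K₀ Kd≈0 n = agree (suc n) n ℕₚ.≤-refl
  where
  leading : ∀ n → Agree n d 0F → (K ⊛ d) n ≡ K 0 ℤ.* d n
  leading zero    _  = refl
  leading (suc n) ag = trans (cong (ℤ._+_ (K 0 ℤ.* d (suc n))) tail≡0) (ℤₚ.+-identityʳ _)
    where
    tail≡0 : (tail K ⊛ d) n ≡ + 0
    tail≡0 = trans (⊛-agree n (λ _ _ → refl) ag)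
                   (trans (sym (⊗≈⊛ (tail K) 0F n)) (trans (zeroʳ (tail K) n) (0F≡0 n)))

  coefficient : ∀ n → Agree n d 0F → d n ≡ + 0
  coefficient n ag = begin
    d n               ≡⟨ ℤₚ.*-identityˡ (d n) ⟨
    + 1 ℤ.* d n       ≡⟨ cong (ℤ._* d n) K₀ ⟨
    K 0 ℤ.* d n       ≡⟨ leading n ag ⟨
    (K ⊛ d) n         ≡⟨ ⊗≈⊛ K d n ⟨
    (K ⊗ d) n         ≡⟨ trans (Kd≈0 n) (0F≡0 n) ⟩
    + 0               ∎
    where open ≡-Reasoning

  agree : ∀ n → Agree n d 0F
  agree zero    m ()
  agree (suc n) m (s≤s m≤n) with ℕₚ.m≤n⇒m<n∨m≡n m≤n
  ... | inj₁ m<n  = agree n m m<n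
  ... | inj₂ refl = trans (coefficient m (agree m)) (sym (0F≡0 m))

sub2-cong : ∀ {f g} → f ≈ g → sub2 f ≈ sub2 g
sub2-cong p zero          = p 0
sub2-cong p (suc zero)    = refl
sub2-cong p (suc (suc n)) = sub2-cong (p ∘ suc) n

sub2-⊕ : ∀ f g → sub2 (f ⊕ g) ≈ sub2 f ⊕ sub2 g
sub2-⊕ f g zero          = refl
sub2-⊕ f g (suc zero)    = refl
sub2-⊕ f g (suc (suc n)) = sub2-⊕ (tail f) (tail g) n

sub2-· : ∀ c f → sub2 (c · f) ≈ c · sub2 f
sub2-· c f zero          = refl
sub2-· c f (suc zero)    = sym (ℤₚ.*-zeroʳ c)
sub2-· c f (suc (suc n)) = sub2-· c (tail f) n

sub2-zeros : ∀ n → sub2 (λ _ → + 0) n ≡ + 0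
sub2-zeros zero          = refl
sub2-zeros (suc zero)    = refl
sub2-zeros (suc (suc n)) = sub2-zeros n

sub2-κ : ∀ c → sub2 (κ c) ≈ κ c
sub2-κ c zero          = refl
sub2-κ c (suc zero)    = refl
sub2-κ c (suc (suc n)) = sub2-zeros n

sub2-shift : ∀ f → sub2 (shift f) ≈ shift (shift (sub2 f))
sub2-shift f zero          = refl
sub2-shift f (suc zero)    = refl
sub2-shift f (suc (suc n)) = refl

tail-sub2 : ∀ f → tail (sub2 f) ≈ shift (sub2 (tail f))
tail-sub2 f zero    = refl
tail-sub2 f (suc n) = refl

sub2-⊛ : ∀ f g → sub2 (f ⊛ g) ≈ sub2 f ⊛ sub2 g
sub2-⊛ f g zero          = refl
sub2-⊛ f g (suc zero)    = sym (trans (ℤₚ.+-identityʳ _) (ℤₚ.*-zeroʳ (f 0)))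
sub2-⊛ f g (suc (suc n)) = begin
    sub2 (f 0 · tail g ⊕ tail f ⊛ g) n
  ≡⟨ sub2-⊕ (f 0 · tail g) (tail f ⊛ g) n ⟩
    sub2 (f 0 · tail g) n ℤ.+ sub2 (tail f ⊛ g) n
  ≡⟨ cong₂ ℤ._+_ (sub2-· (f 0) (tail g) n) (sub2-⊛ (tail f) g n) ⟩
    f 0 ℤ.* sub2 g (suc (suc n)) ℤ.+ (sub2 (tail f) ⊛ sub2 g) n
  ≡⟨ cong (ℤ._+_ (f 0 ℤ.* sub2 g (suc (suc n)))) (⊛-shiftˡ (sub2 (tail f)) (sub2 g) (suc n)) ⟨
    f 0 ℤ.* sub2 g (suc (suc n)) ℤ.+ (shift (sub2 (tail f)) ⊛ sub2 g) (suc n)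
  ≡⟨ cong (ℤ._+_ (f 0 ℤ.* sub2 g (suc (suc n)))) (⊛-cong (tail-sub2 f) (≈-refl {sub2 g}) (suc n)) ⟨
    f 0 ℤ.* sub2 g (suc (suc n)) ℤ.+ (tail (sub2 f) ⊛ sub2 g) (suc n)
  ∎
  where open ≡-Reasoning

sub2-⊗ : ∀ f g → sub2 (f ⊗ g) ≈ sub2 f ⊗ sub2 g
sub2-⊗ f g = ≈-trans (sub2-cong (⊗≈⊛ f g)) (≈-trans (sub2-⊛ f g) (≈-sym (⊗≈⊛ (sub2 f) (sub2 g))))

sub2-zpow : ∀ k → sub2 (zpow k) ≈ zpow (k ℕ.+ k)
sub2-zpow zero    = ≈-trans (sub2-cong zpow-zero) (≈-trans (sub2-κ (+ 1)) (≈-sym zpow-zero))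
sub2-zpow (suc k) = begin
  sub2 (zpow (suc k))                 ≈⟨ sub2-cong (zpow-suc k) ⟩
  sub2 (shift (zpow k))               ≈⟨ sub2-shift (zpow k) ⟩
  shift (shift (sub2 (zpow k)))       ≈⟨ shift-cong (shift-cong (sub2-zpow k)) ⟩
  shift (shift (zpow (k ℕ.+ k)))      ≈⟨ ≈-sym (≈-trans (zpow-suc _) (shift-cong (zpow-suc _))) ⟩
  zpow (suc (suc (k ℕ.+ k)))          ≡⟨ cong (zpow ∘ suc) (ℕₚ.+-suc k k) ⟨
  zpow (suc k ℕ.+ suc k)              ∎
  where open ≈-Reasoning

sub2-double : ∀ f n → sub2 f (n ℕ.+ n) ≡ f n
sub2-double f zero    = refl
sub2-double f (suc n) rewrite ℕₚ.+-suc n n = sub2-double (tail f) n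

sub2-injective : ∀ {f g} → sub2 f ≈ sub2 g → f ≈ g
sub2-injective {f} {g} p n = trans (sym (sub2-double f n)) (trans (p (n ℕ.+ n)) (sub2-double g n))

sub2-unique : ∀ f F → (∀ n → F (n ℕ.+ n) ≡ f n) → (∀ n → F (suc (n ℕ.+ n)) ≡ + 0) → sub2 f ≈ F
sub2-unique f F evens odds zero          = sym (evens 0)
sub2-unique f F evens odds (suc zero)    = sym (odds 0)
sub2-unique f F evens odds (suc (suc n)) = sub2-unique (tail f) (tail (tail F)) evens′ odds′ n
  where
  evens′ : ∀ n → F (suc (suc (n ℕ.+ n))) ≡ f (suc n)
  evens′ n = trans (cong (F ∘ suc) (sym (ℕₚ.+-suc n n))) (evens (suc n))
  odds′ : ∀ n → F (suc (suc (suc (n ℕ.+ n)))) ≡ + 0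
  odds′ n = trans (cong (F ∘ suc ∘ suc) (sym (ℕₚ.+-suc n n))) (odds (suc n))

-- Φ z² z⁴ g = z²(1+g) + z⁴ g (1+g)²; the paper's equation g₀ = z²(1+g₀)/(1 - z⁴(1+g₀)²)
-- is g₀ = Φ z² z⁴ g₀ with the denominator cleared.
Φ : FPS → FPS → FPS → FPS
Φ s q g = s ⊗ (1F ⊕ g) ⊕ q ⊗ (g ⊗ ((1F ⊕ g) ⊗ (1F ⊕ g)))

cubic : FPS → FPS → FPS → FPS
cubic s q w = (w ⊗ w ⊗ w) ⊕ ((s ⊖ 1F) ⊗ (w ⊗ w)) ⊖ (q ⊗ w) ⊕ q

Φ-cong : ∀ {s s′ q q′ g g′} → s ≈ s′ → q ≈ q′ → g ≈ g′ → Φ s q g ≈ Φ s′ q′ g′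
Φ-cong s≈ q≈ g≈ = ⊕-cong (⊗-cong s≈ h≈) (⊗-cong q≈ (⊗-cong g≈ (⊗-cong h≈ h≈)))
  where h≈ = ⊕-cong (≈-refl {1F}) g≈

sub2-1+ : ∀ g → sub2 (1F ⊕ g) ≈ 1F ⊕ sub2 g
sub2-1+ g = ≈-trans (sub2-⊕ 1F g) (⊕-cong (sub2-κ (+ 1)) (≈-refl {sub2 g}))

sub2-Φ : ∀ s q g → sub2 (Φ s q g) ≈ Φ (sub2 s) (sub2 q) (sub2 g)
sub2-Φ s q g =
  ≈-trans (sub2-⊕ (s ⊗ h) (q ⊗ (g ⊗ (h ⊗ h))))
    (⊕-cong (≈-trans (sub2-⊗ s h) (⊗-congˡ (sub2 s) (sub2-1+ g)))
            (≈-trans (sub2-⊗ q _) (⊗-congˡ (sub2 q) (≈-trans (sub2-⊗ g _) (⊗-congˡ (sub2 g)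
              (≈-trans (sub2-⊗ h h) (⊗-cong (sub2-1+ g) (sub2-1+ g))))))))
  where h = 1F ⊕ g

data Run : Set where
  none odd even : Run

closable : Run → Bool
closable none = true
closable odd  = true
closable even = false

extend : Run → Run
extend none = odd
extend odd  = even
extend even = odd

-- paths L h r counts the step sequences of length L which, started at height h while
-- reading a descent whose length so far lies in the parity class r, never go below
-- the axis, end on it, and give every descent odd length.
mutual
  paths : ℕ → ℕ → Run → ℕ
  paths zero    zero    r = if closable r then 1 else 0
  paths zero    (suc h) r = 0
  paths (suc L) h       r = (if closable r then paths L (suc h) none else 0) ℕ.+ descend L h r

  descend : ℕ → ℕ → Run → ℕ
  descend L zero    r = 0
  descend L (suc h) r = paths L h (extend r)

isOdd-suc-double : ∀ n → isOdd (suc (n ℕ.+ n)) ≡ true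
isOdd-suc-double zero    = refl
isOdd-suc-double (suc n) = trans (cong isOdd (ℕₚ.+-suc n n)) (isOdd-suc-double n)

paths-odd : ∀ L h r → isOdd (L ℕ.+ h) ≡ true → paths L h r ≡ 0
paths-odd zero    zero    r ()
paths-odd zero    (suc h) r _          = refl
paths-odd (suc L) h       r odd-length = cong₂ ℕ._+_ ascend≡0 (descend≡0 h odd-length)
  where
  ascend≡0 : (if closable r then paths L (suc h) none else 0) ≡ 0
  ascend≡0 with closable r
  ... | true  = paths-odd L (suc h) none (trans (cong isOdd (ℕₚ.+-suc L h)) odd-length)
  ... | false = refl
  descend≡0 : ∀ h → isOdd (suc L ℕ.+ h) ≡ true → descend L h r ≡ 0
  descend≡0 zero    _ = refl
  descend≡0 (suc h) odd-length =
    paths-odd L h (extend r) (trans (sym (cong (isOdd ∘ suc) (ℕₚ.+-suc L h))) odd-length)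

runOf : ℕ → Run
runOf zero                = none
runOf (suc zero)          = odd
runOf (suc (suc zero))    = even
runOf (suc (suc (suc c))) = runOf (suc c)

runOf-suc : ∀ c → runOf (suc c) ≡ extend (runOf c)
runOf-suc zero                = refl
runOf-suc (suc zero)          = refl
runOf-suc (suc (suc zero))    = refl
runOf-suc (suc (suc (suc c))) = runOf-suc (suc c)

isOdd≡closable-runOf : ∀ c → isOdd (suc c) ≡ closable (runOf (suc c))
isOdd≡closable-runOf zero          = refl
isOdd≡closable-runOf (suc zero)    = refl
isOdd≡closable-runOf (suc (suc c)) = isOdd≡closable-runOf c

endsOnAxis : Maybe ℕ → Bool
endsOnAxis (just zero) = true
endsOnAxis _           = false

Valid : ℕ → ℕ → List Step → Bool
Valid h c s = endsOnAxis (walk h s) ∧ allOdd (descentsFrom c s)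

Valid-[] : ∀ c → Valid 0 c [] ≡ closable (runOf c)
Valid-[] zero    = refl
Valid-[] (suc c) = trans (Boolₚ.∧-identityʳ (isOdd (suc c))) (isOdd≡closable-runOf c)

Valid-U : ∀ h c s → Valid h c (U ∷ s) ≡ closable (runOf c) ∧ Valid (suc h) 0 s
Valid-U h zero    s = refl
Valid-U h (suc c) s = begin
    onAxis ∧ (isOdd (suc c) ∧ allOdd (descentsFrom 0 s))
  ≡⟨ cong (λ b → onAxis ∧ (b ∧ allOdd (descentsFrom 0 s))) (isOdd≡closable-runOf c) ⟩
    onAxis ∧ (closable (runOf (suc c)) ∧ allOdd (descentsFrom 0 s))
  ≡⟨ ∧-swap onAxis (closable (runOf (suc c))) (allOdd (descentsFrom 0 s)) ⟩
    closable (runOf (suc c)) ∧ Valid (suc h) 0 s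
  ∎
  where
  open ≡-Reasoning
  onAxis = endsOnAxis (walk (suc h) s)
  ∧-swap : ∀ a b c → a ∧ (b ∧ c) ≡ b ∧ (a ∧ c)
  ∧-swap a b c = trans (sym (Boolₚ.∧-assoc a b c))
                       (trans (cong (_∧ c) (Boolₚ.∧-comm a b)) (Boolₚ.∧-assoc b a c))

Valid-D : ∀ h c s → Valid (suc h) c (D ∷ s) ≡ Valid h (suc c) s
Valid-D h zero    s = refl
Valid-D h (suc c) s = refl

count : (List Step → Bool) → List (List Step) → ℕ
count p ws = length (filterᵇ p ws)

count-∷ : ∀ p w ws → count p (w ∷ ws) ≡ (if p w then 1 else 0) ℕ.+ count p ws
count-∷ p w ws with p w
... | true  = refl
... | false = refl

count-cong : ∀ {p q} → (∀ s → p s ≡ q s) → ∀ ws → count p ws ≡ count q ws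
count-cong p≡q []       = refl
count-cong p≡q (w ∷ ws) =
  trans (count-∷ _ w ws) (trans (cong₂ (λ b n → (if b then 1 else 0) ℕ.+ n) (p≡q w) (count-cong p≡q ws))
                                (sym (count-∷ _ w ws)))

count-false : ∀ ws → count (λ _ → false) ws ≡ 0
count-false []       = refl
count-false (w ∷ ws) = count-false ws

count-guard : ∀ b p ws → count (λ s → b ∧ p s) ws ≡ (if b then count p ws else 0)
count-guard true  p ws = refl
count-guard false p ws = count-false ws

count-U∷D∷ : ∀ p ws → count p (concatMap (λ w → (U ∷ w) ∷ (D ∷ w) ∷ []) ws)
                      ≡ count (p ∘ (U ∷_)) ws ℕ.+ count (p ∘ (D ∷_)) ws
count-U∷D∷ p []       = refl
count-U∷D∷ p (w ∷ ws) = begin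
    count p ((U ∷ w) ∷ (D ∷ w) ∷ rest)
  ≡⟨ trans (count-∷ p _ _) (cong (ℕ._+_ u) (count-∷ p _ _)) ⟩
    u ℕ.+ (d ℕ.+ count p rest)
  ≡⟨ cong (λ n → u ℕ.+ (d ℕ.+ n)) (count-U∷D∷ p ws) ⟩
    u ℕ.+ (d ℕ.+ (us ℕ.+ ds))
  ≡⟨ trans (sym (ℕₚ.+-assoc u d (us ℕ.+ ds))) (interchange u d us ds) ⟩
    (u ℕ.+ us) ℕ.+ (d ℕ.+ ds)
  ≡⟨ cong₂ ℕ._+_ (count-∷ (p ∘ (U ∷_)) w ws) (count-∷ (p ∘ (D ∷_)) w ws) ⟨
    count (p ∘ (U ∷_)) (w ∷ ws) ℕ.+ count (p ∘ (D ∷_)) (w ∷ ws)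
  ∎
  where
  open ≡-Reasoning
  open import Algebra.Properties.CommutativeSemigroup ℕₚ.+-commutativeSemigroup using (interchange)
  rest = concatMap (λ w → (U ∷ w) ∷ (D ∷ w) ∷ []) ws
  u = if p (U ∷ w) then 1 else 0
  d = if p (D ∷ w) then 1 else 0
  us = count (p ∘ (U ∷_)) ws
  ds = count (p ∘ (D ∷_)) ws

count≡paths : ∀ L h c → count (Valid h c) (words L) ≡ paths L h (runOf c)
count≡paths zero    zero    c =
  trans (count-∷ (Valid 0 c) [] []) (trans (ℕₚ.+-identityʳ _) (cong (λ b → if b then 1 else 0) (Valid-[] c)))
count≡paths zero    (suc h) c = refl
count≡paths (suc L) h       c =
  trans (count-U∷D∷ (Valid h c) (words L)) (cong₂ ℕ._+_ ascend (descend≡ h))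
  where
  ascend : count (Valid h c ∘ (U ∷_)) (words L) ≡ (if closable (runOf c) then paths L (suc h) none else 0)
  ascend = begin
      count (Valid h c ∘ (U ∷_)) (words L)
    ≡⟨ count-cong (Valid-U h c) (words L) ⟩
      count (λ s → closable (runOf c) ∧ Valid (suc h) 0 s) (words L)
    ≡⟨ count-guard (closable (runOf c)) _ (words L) ⟩
      (if closable (runOf c) then count (Valid (suc h) 0) (words L) else 0)
    ≡⟨ cong (λ n → if closable (runOf c) then n else 0) (count≡paths L (suc h) 0) ⟩
      (if closable (runOf c) then paths L (suc h) none else 0)
    ∎
    where open ≡-Reasoning
  descend≡ : ∀ h → count (Valid h c ∘ (D ∷_)) (words L) ≡ descend L h (runOf c)
  descend≡ zero    = count-false (words L)
  descend≡ (suc h) = trans (count-cong (Valid-D h c) (words L))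
                           (trans (count≡paths L h (suc c)) (cong (paths L h) (runOf-suc c)))

a≡paths : ∀ n → a (suc n) ≡ paths (suc n ℕ.+ suc n) 0 none
a≡paths n = begin
  a (suc n)                                   ≡⟨ count-cong isDyck-∧ (words (2 ℕ.* suc n)) ⟩
  count (Valid 0 0) (words (2 ℕ.* suc n))     ≡⟨ count≡paths (2 ℕ.* suc n) 0 0 ⟩
  paths (2 ℕ.* suc n) 0 none                  ≡⟨ cong (λ L → paths (suc n ℕ.+ L) 0 none) (ℕₚ.+-identityʳ (suc n)) ⟩
  paths (suc n ℕ.+ suc n) 0 none              ∎
  where
  open ≡-Reasoning
  isDyck-∧ : ∀ p → isDyck p ∧ allOdd (descents p) ≡ Valid 0 0 p
  isDyck-∧ p with walk 0 p
  ... | just zero    = refl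
  ... | just (suc _) = refl
  ... | nothing      = refl

z : FPS
z = zpow 1

tail-z⊗ : ∀ f → tail (z ⊗ f) ≈ f
tail-z⊗ f n = zpow1⊗ f (suc n)

zpow2≈ : zpow 2 ≈ z ⊗ z
zpow2≈ = zpow-+ 1 1

zpow4≈ : zpow 4 ≈ (z ⊗ z) ⊗ (z ⊗ z)
zpow4≈ = ≈-trans (zpow-+ 2 2) (⊗-cong zpow2≈ zpow2≈)

gs-contracting : Contracting (Φ (zpow 2) (zpow 4))
gs-contracting p = Agree-⊕ (Agree-⊗-vanishing (zpow 2) refl h)
                           (Agree-⊗-vanishing (zpow 4) refl (Agree-⊗ p (Agree-⊗ h h)))
  where h = Agree-⊕ {f = 1F} {1F} (λ _ _ → refl) p

gs : FPS
gs = Fixpoint.fix (Φ (zpow 2) (zpow 4)) gs-contracting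

gs-equation : gs ≈ Φ (zpow 2) (zpow 4) gs
gs-equation = Fixpoint.fix-unfold (Φ (zpow 2) (zpow 4)) gs-contracting

gs-equationᶻ : gs ≈ Φ (z ⊗ z) ((z ⊗ z) ⊗ (z ⊗ z)) gs
gs-equationᶻ = ≈-trans gs-equation (Φ-cong zpow2≈ zpow4≈ (≈-refl {gs}))

-- V h r is the generating function Σ_L paths L h r z^L (paths-coeff).  It follows the
-- transfer recursion, except that V (2 + h) none, which would refer to a greater height,
-- is replaced by the closed form climb h; V-climb justifies this from the equation of gs.
mutual
  V : ℕ → Run → FPS
  V zero    r = if closable r then 1F ⊕ gs else 0F
  V (suc h) r = z ⊗ ((if closable r then climb h else 0F) ⊕ V h (extend r))

  climb : ℕ → FPS
  climb h = gs ⊗ V h even ⊕ z ⊗ z ⊗ gs ⊗ (1F ⊕ gs) ⊗ V h odd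

V-climb : ∀ h → V (suc (suc h)) none ≈ climb h
V-climb h = x∙y⁻¹≈ε⇒x≈y _ _
  (≈-trans (certificate z gs (V h even) (V h odd))
           (multiple≈0 (V h even ⊕ z ⊗ z ⊗ gs ⊗ V h odd) (x≈y⇒x∙y⁻¹≈ε (≈-sym gs-equationᶻ))))
  where
  certificate : ∀ x g A B →
    let s = x ⊗ x ; e = s ⊗ g ⊗ (1F ⊕ g) ; c = g ⊗ A ⊕ e ⊗ B in
    x ⊗ ((g ⊗ (x ⊗ (0F ⊕ B)) ⊕ e ⊗ (x ⊗ (c ⊕ A))) ⊕ x ⊗ (c ⊕ A)) ⊖ c
      ≈ (Φ s (s ⊗ s) g ⊖ g) ⊗ (A ⊕ s ⊗ g ⊗ B)
  certificate = solve≡ 4 (λ x g A B →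
    let s = x :* x ; e = s :* g :* (:1 :+ g) ; c = g :* A :+ e :* B in
    x :* ((g :* (x :* (con (+ 0) :+ B)) :+ e :* (x :* (c :+ A))) :+ x :* (c :+ A)) :- c
      := (:Φ s (s :* s) g :- g) :* (A :+ s :* g :* B)) refl

gs≈z⊗V₁ : gs ≈ z ⊗ V 1 none
gs≈z⊗V₁ = ≈-trans gs-equationᶻ (identity z gs)
  where
  identity : ∀ x g →
    let s = x ⊗ x ; e = s ⊗ g ⊗ (1F ⊕ g) in
    Φ s (s ⊗ s) g ≈ x ⊗ (x ⊗ ((g ⊗ 0F ⊕ e ⊗ (1F ⊕ g)) ⊕ (1F ⊕ g)))
  identity = solve≡ 2 (λ x g →
    let s = x :* x ; e = s :* g :* (:1 :+ g) in
    :Φ s (s :* s) g := x :* (x :* ((g :* con (+ 0) :+ e :* (:1 :+ g)) :+ (:1 :+ g)))) refl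

descendV : ℕ → Run → FPS
descendV zero    r = 0F
descendV (suc h) r = V h (extend r)

V-tail : ∀ h r → tail (V h r) ≈ (if closable r then V (suc h) none else 0F) ⊕ descendV h r
V-tail zero    none = tail-1+gs
  where
  tail-1+gs : tail (1F ⊕ gs) ≈ V 1 none ⊕ 0F
  tail-1+gs = begin
    tail (1F ⊕ gs)      ≈⟨ (λ n → ℤₚ.+-identityˡ (gs (suc n))) ⟩
    tail gs             ≈⟨ (λ n → gs≈z⊗V₁ (suc n)) ⟩
    tail (z ⊗ V 1 none) ≈⟨ tail-z⊗ (V 1 none) ⟩
    V 1 none            ≈⟨ +-identityʳ (V 1 none) ⟨
    V 1 none ⊕ 0F       ∎
    where open ≈-Reasoning
V-tail zero    odd  = V-tail zero none
V-tail zero    even = λ n → sym (cong₂ ℤ._+_ (0F≡0 n) (0F≡0 n))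
V-tail (suc h) r    = ≈-trans (tail-z⊗ _) (⊕-cong (ascent r) (≈-refl {V h (extend r)}))
  where
  ascent : ∀ r → (if closable r then climb h else 0F) ≈ (if closable r then V (suc (suc h)) none else 0F)
  ascent none = ≈-sym (V-climb h)
  ascent odd  = ≈-sym (V-climb h)
  ascent even = ≈-refl {0F}

paths-coeff : ∀ L h r → + paths L h r ≡ V h r L
paths-coeff zero    zero    none = refl
paths-coeff zero    zero    odd  = refl
paths-coeff zero    zero    even = refl
paths-coeff zero    (suc h) r    = sym (zpow1⊗ ((if closable r then climb h else 0F) ⊕ V h (extend r)) 0)
paths-coeff (suc L) h       r    = begin
    + (ascent ℕ.+ descend L h r)
  ≡⟨ ℤₚ.pos-+ ascent (descend L h r) ⟩
    + ascent ℤ.+ + descend L h r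
  ≡⟨ cong₂ ℤ._+_ ascent-coeff (descend-coeff h) ⟩
    (if closable r then V (suc h) none else 0F) L ℤ.+ descendV h r L
  ≡⟨ V-tail h r L ⟨
    V h r (suc L)
  ∎
  where
  open ≡-Reasoning
  ascent = if closable r then paths L (suc h) none else 0
  ascent-coeff : + ascent ≡ (if closable r then V (suc h) none else 0F) L
  ascent-coeff = guarded r
    where
    guarded : ∀ r → + (if closable r then paths L (suc h) none else 0) ≡ (if closable r then V (suc h) none else 0F) L
    guarded none = paths-coeff L (suc h) none
    guarded odd  = paths-coeff L (suc h) none
    guarded even = sym (0F≡0 L)
  descend-coeff : ∀ h → + descend L h r ≡ descendV h r L
  descend-coeff zero    = sym (0F≡0 L)
  descend-coeff (suc h) = paths-coeff L h (extend r)

1+g₀≈paths : 1F ⊕ g₀ ≈ (λ L → + paths L 0 none)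
1+g₀≈paths = ≈-trans (⊕-cong (≈-sym (sub2-κ (+ 1))) (≈-refl {g₀}))
                     (≈-trans (≈-sym (sub2-⊕ 1F G)) (sub2-unique (1F ⊕ G) _ evens odds))
  where
  evens : ∀ n → + paths (n ℕ.+ n) 0 none ≡ (1F ⊕ G) n
  evens zero    = refl
  evens (suc n) = cong +_ (sym (a≡paths n))
  odds : ∀ n → + paths (suc (n ℕ.+ n)) 0 none ≡ + 0
  odds n = cong +_ (paths-odd (suc (n ℕ.+ n)) 0 none
                              (trans (cong isOdd (ℕₚ.+-identityʳ (suc (n ℕ.+ n)))) (isOdd-suc-double n)))

g₀≈gs : g₀ ≈ gs
g₀≈gs = ∙-cancelˡ 1F g₀ gs (≈-trans 1+g₀≈paths (λ L → paths-coeff L 0 none))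

g₀-relation : g₀ ≈ Φ (zpow 2) (zpow 4) g₀
g₀-relation = ≈-trans g₀≈gs (≈-trans gs-equation (Φ-cong (≈-refl {zpow 2}) (≈-refl {zpow 4}) (≈-sym g₀≈gs)))

G-relation : G ≈ Φ (zpow 1) (zpow 2) G
G-relation = sub2-injective (≈-trans g₀-relation
  (≈-sym (≈-trans (sub2-Φ (zpow 1) (zpow 2) G) (Φ-cong (sub2-zpow 1) (sub2-zpow 2) (≈-refl {g₀})))))

W : FPS
W = recip G refl

w₁ : FPS
w₁ = sub2 W

w₁-inverse : w₁ ⊗ (1F ⊕ g₀) ≈ 1F
w₁-inverse = begin
  w₁ ⊗ (1F ⊕ g₀)          ≈⟨ ⊗-congˡ w₁ (sub2-1+ G) ⟨
  w₁ ⊗ sub2 (1F ⊕ G)      ≈⟨ sub2-⊗ W (1F ⊕ G) ⟨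
  sub2 (W ⊗ (1F ⊕ G))     ≈⟨ sub2-cong (recip-inverse G refl) ⟩
  sub2 1F                 ≈⟨ sub2-κ (+ 1) ⟩
  1F                      ∎
  where open ≈-Reasoning

relation-defect : g₀ ⊖ Φ (zpow 2) (zpow 4) g₀ ≈ 0F
relation-defect = x≈y⇒x∙y⁻¹≈ε g₀-relation

inverse-is-root : ∀ w → w ⊗ (1F ⊕ g₀) ≈ 1F → CubicRoot w
inverse-is-root w inverse =
  ⊗-cancel-unit h _ refl (⊗-cancel-unit h _ refl (⊗-cancel-unit h _ refl
    (≈-trans (certificate (zpow 2) (zpow 4) g₀ w)
             (combination≈0 (κ -[1+ 0 ]) (cofactor (zpow 2) (zpow 4) g₀ w)
                            relation-defect (x≈y⇒x∙y⁻¹≈ε inverse)))))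
  where
  h = 1F ⊕ g₀
  -- h³ · cubic(w) is, at e = w h = 1, the relation's defect; what remains is a multiple of e - 1
  cofactor : FPS → FPS → FPS → FPS → FPS
  cofactor s q g w = let h = 1F ⊕ g ; e = w ⊗ h in
    e ⊗ e ⊕ e ⊕ 1F ⊕ (s ⊖ 1F) ⊗ h ⊗ (e ⊕ 1F) ⊖ q ⊗ h ⊗ h
  certificate : ∀ s q g w → let h = 1F ⊕ g in
    h ⊗ (h ⊗ (h ⊗ cubic s q w))
      ≈ (g ⊖ Φ s q g) ⊗ κ -[1+ 0 ] ⊕ (w ⊗ h ⊖ 1F) ⊗ cofactor s q g w
  certificate = solve≡ 4 (λ s q g w → let h = :1 :+ g ; e = w :* h in
    h :* (h :* (h :* :cubic s q w))
      := (g :- :Φ s q g) :* con -[1+ 0 ]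
         :+ (e :- :1) :* (e :* e :+ e :+ :1 :+ (s :- :1) :* h :* (e :+ :1) :- q :* h :* h)) refl

cubic-quotient : FPS → FPS → FPS → FPS → FPS
cubic-quotient s q w w′ = w ⊗ w ⊕ w ⊗ w′ ⊕ w′ ⊗ w′ ⊕ (s ⊖ 1F) ⊗ (w ⊕ w′) ⊖ q

cubic-difference : ∀ s q w w′ → cubic s q w ⊖ cubic s q w′ ≈ cubic-quotient s q w w′ ⊗ (w ⊖ w′)
cubic-difference = solve≡ 4 (λ s q w w′ →
  :cubic s q w :- :cubic s q w′
    := (w :* w :+ w :* w′ :+ w′ :* w′ :+ (s :- :1) :* (w :+ w′) :- q) :* (w :- w′)) refl

cubic-quotient-constant : ∀ w w′ → w 0 ≡ + 1 → w′ 0 ≡ + 1 → cubic-quotient (zpow 2) (zpow 4) w w′ 0 ≡ + 1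
cubic-quotient-constant w w′ w₀ w₀′ rewrite w₀ | w₀′ = refl

cubic-unique : ∀ w w′ → CubicRoot w → w 0 ≡ + 1 → CubicRoot w′ → w′ 0 ≡ + 1 → w ≈ w′
cubic-unique w w′ root w₀ root′ w₀′ =
  x∙y⁻¹≈ε⇒x≈y w w′ (⊗-cancel-unit (cubic-quotient (zpow 2) (zpow 4) w w′) (w ⊖ w′)
                                   (cubic-quotient-constant w w′ w₀ w₀′)
    (≈-trans (≈-sym (cubic-difference (zpow 2) (zpow 4) w w′)) (x≈y⇒x∙y⁻¹≈ε (≈-trans root (≈-sym root′)))))

pole-identity : ∀ w → w ⊗ (1F ⊕ g₀) ≈ 1F → g₀ ⊗ ((w ⊗ w) ⊖ zpow 4) ≈ zpow 2 ⊗ w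
pole-identity w inverse =
  x∙y⁻¹≈ε⇒x≈y (g₀ ⊗ ((w ⊗ w) ⊖ zpow 4)) (zpow 2 ⊗ w)
    (⊗-cancel-unit h _ refl (⊗-cancel-unit h _ refl
      (≈-trans (certificate (zpow 2) (zpow 4) g₀ w)
               (combination≈0 1F (g₀ ⊗ (w ⊗ h ⊕ 1F) ⊖ zpow 2 ⊗ h)
                              relation-defect (x≈y⇒x∙y⁻¹≈ε inverse)))))
  where
  h = 1F ⊕ g₀
  certificate : ∀ s q g w → let h = 1F ⊕ g in
    h ⊗ (h ⊗ (g ⊗ ((w ⊗ w) ⊖ q) ⊖ s ⊗ w))
      ≈ (g ⊖ Φ s q g) ⊗ 1F ⊕ (w ⊗ h ⊖ 1F) ⊗ (g ⊗ (w ⊗ h ⊕ 1F) ⊖ s ⊗ h)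
  certificate = solve≡ 4 (λ s q g w → let h = :1 :+ g in
    h :* (h :* (g :* ((w :* w) :- q) :- s :* w))
      := (g :- :Φ s q g) :* :1 :+ (w :* h :- :1) :* (g :* (w :* h :+ :1) :- s :* h)) refl

relation-cleared : g₀ ⊗ (κ (+ 1) ⊖ (zpow 4 ⊗ ((κ (+ 1) ⊕ g₀) ⊗ (κ (+ 1) ⊕ g₀)))) ≈ zpow 2 ⊗ (κ (+ 1) ⊕ g₀)
relation-cleared = x∙y⁻¹≈ε⇒x≈y _ _ (≈-trans (identity (zpow 2) (zpow 4) g₀) relation-defect)
  where
  identity : ∀ s q g → g ⊗ (1F ⊖ (q ⊗ ((1F ⊕ g) ⊗ (1F ⊕ g)))) ⊖ s ⊗ (1F ⊕ g) ≈ g ⊖ Φ s q g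
  identity = solve≡ 3 (λ s q g →
    g :* (:1 :- (q :* ((:1 :+ g) :* (:1 :+ g)))) :- s :* (:1 :+ g) := g :- :Φ s q g) refl

G-cubic : (⊝ (zpow 2 ⊗ G ⊗ G ⊗ G)) ⊖ (κ (+ 2) ⊗ zpow 2 ⊗ G ⊗ G) ⊕ G ⊖ (zpow 2 ⊗ G) ⊖ (zpow 1 ⊗ G) ⊖ zpow 1 ≈ κ (+ 0)
G-cubic = ≈-trans (identity (zpow 1) (zpow 2) G) (x≈y⇒x∙y⁻¹≈ε G-relation)
  where
  identity : ∀ s q g →
    (⊝ (q ⊗ g ⊗ g ⊗ g)) ⊖ (κ (+ 2) ⊗ q ⊗ g ⊗ g) ⊕ g ⊖ (q ⊗ g) ⊖ (s ⊗ g) ⊖ s ≈ g ⊖ Φ s q g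
  identity = solve≡ 3 (λ s q g →
    (:- (q :* g :* g :* g)) :- (con (+ 2) :* q :* g :* g) :+ g :- (q :* g) :- (s :* g) :- s
      := g :- :Φ s q g) refl

mainTheorem1 :
    -- existence of the root v₁ = w/z with v₁ = 1/z - z - z⁵ - 2z⁷ - 4z⁹ - ⋯
    (∃[ w ] (CubicRoot w × Prefix (+ 1 ∷ + 0 ∷ -[1+ 0 ] ∷ + 0 ∷ + 0 ∷ + 0 ∷ -[1+ 0 ] ∷ + 0 ∷ -[1+ 1 ] ∷ + 0 ∷ -[1+ 3 ] ∷ []) w))
    -- uniqueness of the root of the form v₁ = 1/z + (power series in z)
    × (∀ w w′ → CubicRoot w → w 0 ≡ + 1 → CubicRoot w′ → w′ 0 ≡ + 1 → w ≈ w′)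
    -- g₀ = z v₁ / (v₁² - z²), i.e. with v₁ = w/z: g₀ · (w² - z⁴) = z² w
    × (∀ w → CubicRoot w → w 0 ≡ + 1 → g₀ ⊗ ((w ⊗ w) ⊖ zpow 4) ≈ zpow 2 ⊗ w)
    -- g₀ = z²(1+g₀) / (1 - z⁴(1+g₀)²), denominators cleared
    × (g₀ ⊗ (κ (+ 1) ⊖ (zpow 4 ⊗ ((κ (+ 1) ⊕ g₀) ⊗ (κ (+ 1) ⊕ g₀)))) ≈ zpow 2 ⊗ (κ (+ 1) ⊕ g₀))
    -- with Z = z², g₀ = G(Z):  -Z²G³ - 2Z²G² + G - Z²G - ZG - Z = 0
    × ((⊝ (zpow 2 ⊗ G ⊗ G ⊗ G)) ⊖ (κ (+ 2) ⊗ zpow 2 ⊗ G ⊗ G) ⊕ G ⊖ (zpow 2 ⊗ G) ⊖ (zpow 1 ⊗ G) ⊖ zpow 1 ≈ κ (+ 0))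
    -- G = Z + Z² + 2Z³ + 5Z⁴ + 12Z⁵ + 30Z⁶ + 79Z⁷ + ⋯
    × Prefix (+ 0 ∷ + 1 ∷ + 1 ∷ + 2 ∷ + 5 ∷ + 12 ∷ + 30 ∷ + 79 ∷ []) G
mainTheorem1 =
    (w₁ , inverse-is-root w₁ w₁-inverse , (refl , refl , refl , refl , refl , refl , refl , refl , refl , refl , refl , tt))
  , cubic-unique
  , (λ w root w₀ → pole-identity w (≈-trans (⊗-congʳ (1F ⊕ g₀) (cubic-unique w w₁ root w₀ w₁-root refl)) w₁-inverse))
  , relation-cleared
  , G-cubic
  , (refl , refl , refl , refl , refl , refl , refl , refl , tt)
  where
  w₁-root : CubicRoot w₁
  w₁-root = inverse-is-root w₁ w₁-inverse
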